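{- Let $q\ge 2$ and let $k,t_1,\dots,t_q$ be integers with $2 \leq k < t_1, \dots, t_q$, and let $m = \tilde{r}_{k-1}(t_1-1, \dots, t_q-1)$. Then in the $q$-color $k$-uniform vertex online Ramsey game for cliques of sizes $t_1,\dots,t_q$, builder has a strategy that, against every painter strategy, forces for some $c\in[q]$ a copy of $K_{t_c}^{(k)}$ all of whose edges have color $c$, while revealing at most $q^m + k - 2$ vertices and building at most $m \cdot q^m$ edges. In particular, \[ r_k(t_1, \dots, t_q) \leq q^m + k - 2 \qquad\text{and}\qquad \tilde{r}_k(t_1, \dots, t_q) \leq q^{m + \log_q m}. \]
   Context: $K_n^{(k)}$ denotes the complete $k$-uniform hypergraph on $n$ vertices. For integers $k < t_1,\dots,t_q$, the Ramsey number $r_k(t_1,\dots,t_q)$ is the least $n$ such that every $q$-coloring of the edges of $K_n^{(k)}$ contains, for some color $c\in[q]$, a copy of $K_{t_c}^{(k)}$ all of whose edges have color $c$. The $q$-color $k$-uniform vertex online Ramsey game for cliques of sizes $t_1,\dots,t_q$ (with $k<t_1,\dots,t_q$) is played by builder and painter on an ordered vertex set $v_1,v_2,\dots$ of an initially empty $k$-uniform hypergraph, in rounds. At the start of round $i$ the vertex $v_i$ is revealed. During round $i$, builder may build any number of edges of the form $\{v_{i_1},\dots,v_{i_{k-1}},v_i\}$ with $i_1<\dots<i_{k-1}<i$, in any order (adaptively); whenever an edge is built, painter must immediately assign it a color from $[q]$. In each round $i\geq k$ builder must build at least one new edge. Builder's goal is to force, for some $c\in[q]$, a copy of $K_{t_c}^{(k)}$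 all of whose edges are built and have color $c$; painter tries to delay this. The $k$-uniform vertex online Ramsey number $\tilde{r}_k(t_1,\dots,t_q)$ is the minimum number of edges builder must build to force such a monochromatic clique against any painter strategy. These definitions are also used for uniformity $1$ (when $k=2$, the quantity $\tilde r_1$ appears). -}

module Defs where

open import Data.Nat using (ℕ; zero; suc; _+_; _*_; _∸_; _^_; _≤_; _<_)
open import Data.Fin using (Fin)
open import Data.Bool using (Bool; true; false)
open import Data.List using (List; []; _∷_; _∷ʳ_; length)
open import Data.List.Relation.Unary.Linked using (Linked)
open import Data.List.Relation.Unary.All using (All)
open import Data.List.Relation.Binary.Sublist.Propositional using (_⊆_)
open import Data.List.Membership.Propositional using (_∈_; _∉_)
open import Data.Product using (Σ; ∃; _×_; _,_)
open import Data.Sum using (_⊎_)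
open import Relation.Binary.PropositionalEquality using (_≡_)

-- Vertices are natural numbers 0,1,2,... (vertex j is v_{j+1} of the paper).
-- A (hyper)edge / vertex set is represented by a strictly increasing list of
-- vertices; subsets of a strictly increasing list S are exactly its sublists.

StrictIncr : List ℕ → Set
StrictIncr = Linked _<_

Board : ℕ → Set
Board q = List (List ℕ × Fin q)

MonoCliqueOn : ∀ {q} (k : ℕ) (E : Board q) (c : Fin q) (S : List ℕ) → Set
MonoCliqueOn k E c S = ∀ e → e ⊆ S → length e ≡ k → (e , c) ∈ E

HasMonoClique : ∀ {q} (k : ℕ) (t : Fin q → ℕ) (E : Board q) → Set
HasMonoClique {q} k t E =
  Σ (Fin q) λ c → Σ (List ℕ) λ S →
    StrictIncr S × length S ≡ t c × MonoCliqueOn k E c S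

-- Winning positions of builder in the q-colour k-uniform vertex online
-- Ramsey game for cliques of sizes t, with at most V revealed vertices in
-- total and at most B further edges to be built.
--   n : number of revealed vertices (the current vertex is n ∸ 1, i.e. round n)
--   b : whether an edge has already been built in the current round
--   E : the built, coloured edges
-- Moves: builder may build a new edge  xs ∪ {current vertex}  (xs a (k-1)-set
-- of earlier vertices), after which painter chooses any colour; or builder may
-- end the round and reveal the next vertex, which is only allowed if the
-- current round n satisfies n < k or an edge was built in this round.
data Wins {q : ℕ} (k : ℕ) (t : Fin q → ℕ) (V : ℕ) :
          (B n : ℕ) → Bool → Board q → Set where
  done  : ∀ {B n b E} → HasMonoClique k t E → Wins k t V B n b E
  build : ∀ {B n b E} (xs : List ℕ) →
          StrictIncr (xs ∷ʳ (n ∸ 1)) →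
          length xs ≡ k ∸ 1 →
          (∀ c → (xs ∷ʳ (n ∸ 1) , c) ∉ E) →
          (∀ c → Wins k t V B n true ((xs ∷ʳ (n ∸ 1) , c) ∷ E)) →
          Wins k t V (suc B) n b E
  next  : ∀ {B n b E} → (n < k ⊎ b ≡ true) → suc n ≤ V →
          Wins k t V B (suc n) false E →
          Wins k t V B n b E

-- The game starts in round 1 with vertex v_1 revealed and nothing built.
BuilderWins : ∀ {q} (k : ℕ) (t : Fin q → ℕ) (V B : ℕ) → Set
BuilderWins k t V B = 1 ≤ V × Wins k t V B 1 false []

BuilderWinsWithEdges : ∀ {q} (k : ℕ) (t : Fin q → ℕ) (B : ℕ) → Set
BuilderWinsWithEdges k t B = ∃ λ V → BuilderWins k t V B

IsVertexOnlineRamsey : ∀ {q} (k : ℕ) (t : Fin q → ℕ) (m : ℕ) → Set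
IsVertexOnlineRamsey k t m =
  BuilderWinsWithEdges k t m × (∀ m′ → BuilderWinsWithEdges k t m′ → m ≤ m′)

-- Every q-colouring of the k-subsets of {0,...,N-1} has, for some colour c,
-- a set of t c vertices all of whose k-subsets have colour c.
-- (Colourings are given as functions on strictly increasing lists; only
-- their values on k-subsets matter.)  This says  r_k(t_1,...,t_q) ≤ N.
RamseyBound : ∀ {q} (k : ℕ) (t : Fin q → ℕ) (N : ℕ) → Set
RamseyBound {q} k t N =
  (χ : List ℕ → Fin q) →
  Σ (Fin q) λ c → Σ (List ℕ) λ S →
    StrictIncr S × All (_< N) S × length S ≡ t c ×
    (∀ e → e ⊆ S → length e ≡ k → χ e ≡ c)

{-# OPTIONS --safe #-}
-- Erdős–Rado stepping up, played online. Builder fixes a strategy W₀ that wins the (k−1)-uniform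
-- game for the cliques t − 1 with m edges, and keeps a tree of slots over W₀: every vertex reveal
-- of W₀ carries a slot, and the occupants of the slots above a position form a path P of real
-- vertices playing the auxiliary vertices 0, 1, …. A new real vertex w walks down from the root:
-- for each auxiliary edge e′ that W₀ builds, builder builds P[e′] ∪ {w} and follows W₀ into the
-- colour painter chose; w passes occupied slots and settles in the first empty one. Hence every
-- real k-set in P ∪ {w} has the colour of the auxiliary (k−1)-set obtained by deleting its last
-- vertex, so a monochromatic K_{t−1}^{(k−1)} of W₀, lifted to the path and extended by w, is a
-- monochromatic K_t^{(k)}. Before the first edge of W₀ there are k − 2 slots, after it at most
-- q + q² + ⋯ + q^{m−1} ≤ q^m − 2; a vertex settling where W₀ has B edges left has built m − B
-- edges. This bounds the vertices by q^m + k − 2 and the edges by m q^m.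

module Submission where

open import Defs
open import Data.Nat using (ℕ; zero; suc; _+_; _*_; _∸_; _^_; _≤_; _<_; z≤n; s≤s)
open import Data.Nat.Properties
open import Data.Fin using (Fin; zero; suc)
open import Data.Bool using (Bool; true; false)
open import Data.Maybe using (Maybe; just; nothing)
open import Data.Unit using (⊤; tt)
open import Data.List using (List; []; _∷_; _∷ʳ_; length; map; take; initLast; _∷ʳ′_)
open import Data.List.Properties using (length-map; length-++; map-++; length-take; ∷ʳ-injectiveˡ; ∷-injective)
open import Data.List.Relation.Unary.Linked using ([]; [-]; _∷_)
import Data.List.Relation.Unary.Linked as Linked
open import Data.List.Relation.Unary.Linked.Properties using (Linked⇒All)
open import Data.List.Relation.Unary.All using (All; []; _∷_)
import Data.List.Relation.Unary.All as All
open import Data.List.Relation.Unary.All.Properties using (∷ʳ⁺; ∷ʳ⁻; map⁺)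
open import Data.List.Relation.Binary.Sublist.Propositional using (_⊆_; []; _∷_; ⊆-refl; ⊆-trans) renaming (_∷ʳ_ to skip)
open import Data.List.Relation.Binary.Sublist.Propositional.Properties using (All-resp-⊆; take-⊆; ++⁺ʳ)
open import Data.List.Membership.Propositional using (_∈_; _∉_)
open import Data.List.Relation.Binary.Subset.Propositional using () renaming (_⊆_ to _⊆ₛ_)
open import Data.List.Relation.Unary.Any using (here; there)
open import Data.Product using (∃; ∃₂; _×_; _,_; proj₁; proj₂)
open import Data.Sum using (_⊎_; inj₁; inj₂; [_,_]′)
import Data.Sum as Sum
open import Relation.Binary.PropositionalEquality using (_≡_; refl; sym; trans; cong; cong₂; subst; ≢-sym)
open import Relation.Binary.Definitions using (tri<; tri≈; tri>)
open import Relation.Nullary using (¬_; contradiction)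
open import Function using (_∘_; const)
open import Algebra.Properties.CommutativeSemigroup +-commutativeSemigroup using () renaming (x∙yz≈y∙xz to +-left-comm)
open import Algebra.Properties.CommutativeSemigroup *-commutativeSemigroup using () renaming (x∙yz≈y∙xz to *-left-comm)

length-∷ʳ : ∀ {A : Set} (xs : List A) {y : A} → length (xs ∷ʳ y) ≡ suc (length xs)
length-∷ʳ xs = trans (length-++ xs) (+-comm _ 1)

take-length : ∀ {A : Set} {k} (xs : List A) → k ≤ length xs → length (take k xs) ≡ k
take-length {k = k} xs k≤ = trans (length-take k xs) (m≤n⇒m⊓n≡m k≤)

⊆-∷ʳ-split : ∀ {A : Set} {e : List A} ys {w} → e ⊆ ys ∷ʳ w →
  e ⊆ ys ⊎ ∃ λ e₀ → e ≡ e₀ ∷ʳ w × e₀ ⊆ ys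
⊆-∷ʳ-split [] (skip _ []) = inj₁ []
⊆-∷ʳ-split [] (refl ∷ []) = inj₂ ([] , refl , [])
⊆-∷ʳ-split (y ∷ ys) (skip _ τ) with ⊆-∷ʳ-split ys τ
... | inj₁ σ = inj₁ (skip y σ)
... | inj₂ (e₀ , eq , σ) = inj₂ (e₀ , eq , skip y σ)
⊆-∷ʳ-split (y ∷ ys) (refl ∷ τ) with ⊆-∷ʳ-split ys τ
... | inj₁ σ = inj₁ (refl ∷ σ)
... | inj₂ (e₀ , refl , σ) = inj₂ (y ∷ e₀ , refl , refl ∷ σ)

⊆-map-preimage : ∀ {A B : Set} (f : A → B) xs {e} → e ⊆ map f xs → ∃ λ e′ → e′ ⊆ xs × e ≡ map f e′
⊆-map-preimage f [] [] = [] , [] , refl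
⊆-map-preimage f (x ∷ xs) (skip _ τ) with ⊆-map-preimage f xs τ
... | e′ , σ , eq = e′ , skip x σ , eq
⊆-map-preimage f (x ∷ xs) (refl ∷ τ) with ⊆-map-preimage f xs τ
... | e′ , σ , eq = x ∷ e′ , refl ∷ σ , cong (f x ∷_) eq

All-from-sublists : ∀ {P : ℕ → Set} {k} S → 1 ≤ k → k ≤ length S →
  (∀ e → e ⊆ S → length e ≡ k → All P e) → All P S
All-from-sublists {P} {suc k} (x ∷ S) 1≤k (s≤s k≤|S|) cover =
  All.head (cover (x ∷ take k S) (refl ∷ take-⊆ k S) (cong suc (take-length S k≤|S|))) ∷ rest
  where
  rest : All P S
  rest = [ (λ k<|S| → All-from-sublists S 1≤k k<|S| (λ e τ → cover e (skip x τ)))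
         , (λ k≡|S| → All.tail (cover (x ∷ S) ⊆-refl (cong suc (sym k≡|S|)))) ]′ (m≤n⇒m<n∨m≡n k≤|S|)

strict-head : ∀ {x xs} → StrictIncr (x ∷ xs) → All (x <_) xs
strict-head [-] = []
strict-head (x<y ∷ ys↑) = Linked⇒All <-trans x<y ys↑

strict-∷ : ∀ {x xs} → All (x <_) xs → StrictIncr xs → StrictIncr (x ∷ xs)
strict-∷ [] _ = [-]
strict-∷ (x<y ∷ _) ys↑ = x<y ∷ ys↑

strict-∷ʳ⁺ : ∀ {xs y} → StrictIncr xs → All (_< y) xs → StrictIncr (xs ∷ʳ y)
strict-∷ʳ⁺ [] [] = [-]
strict-∷ʳ⁺ [-] (x<y ∷ []) = x<y ∷ [-]
strict-∷ʳ⁺ (x<x′ ∷ xs↑) (_ ∷ xs<y) = x<x′ ∷ strict-∷ʳ⁺ xs↑ xs<y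

strict-∷ʳ⁻ : ∀ xs {y} → StrictIncr (xs ∷ʳ y) → StrictIncr xs × All (_< y) xs
strict-∷ʳ⁻ [] _ = [] , []
strict-∷ʳ⁻ (x ∷ xs) s with strict-∷ʳ⁻ xs (Linked.tail s) | ∷ʳ⁻ {xs = xs} (strict-head s)
... | xs↑ , xs<y | x<xs , x<y = strict-∷ x<xs xs↑ , x<y ∷ xs<y

strict-⊆ : ∀ {e S} → e ⊆ S → StrictIncr S → StrictIncr e
strict-⊆ [] _ = []
strict-⊆ (skip _ τ) S↑ = strict-⊆ τ (Linked.tail S↑)
strict-⊆ (refl ∷ τ) S↑ = strict-∷ (All-resp-⊆ τ (strict-head S↑)) (strict-⊆ τ (Linked.tail S↑))

strict-∷ʳ-length : ∀ {lo} xs {y} → StrictIncr (xs ∷ʳ y) → All (lo ≤_) (xs ∷ʳ y) → lo + length xs ≤ y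
strict-∷ʳ-length [] _ (lo≤y ∷ []) = subst (_≤ _) (sym (+-identityʳ _)) lo≤y
strict-∷ʳ-length {lo} (x ∷ xs) {y} s (lo≤x ∷ _) = begin
  lo + suc (length xs) ≡⟨ +-suc lo (length xs) ⟩
  suc (lo + length xs) ≤⟨ s≤s (+-monoˡ-≤ (length xs) lo≤x) ⟩
  suc x + length xs    ≤⟨ strict-∷ʳ-length xs (Linked.tail s) (strict-head s) ⟩
  y                    ∎
  where open ≤-Reasoning

new-edge-below : ∀ {n} xs → 1 ≤ n → StrictIncr (xs ∷ʳ (n ∸ 1)) → All (_< n) (xs ∷ʳ (n ∸ 1))
new-edge-below {suc n} xs _ s = ∷ʳ⁺ (All.map m<n⇒m<1+n (proj₂ (strict-∷ʳ⁻ xs s))) ≤-refl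

new-edge⇒k≤n : ∀ {k n} xs → 1 ≤ n → StrictIncr (xs ∷ʳ (n ∸ 1)) → length xs ≡ k ∸ 1 → k ≤ n
new-edge⇒k≤n {k} {suc n} xs _ s |xs| = begin
  k               ≤⟨ m≤n+m∸n k 1 ⟩
  suc (k ∸ 1)     ≡⟨ cong suc |xs| ⟨
  suc (length xs) ≤⟨ s≤s (strict-∷ʳ-length xs s (All.universal (λ _ → z≤n) _)) ⟩
  suc n           ∎
  where open ≤-Reasoning

-- The value 0 for i ≥ length P is junk and never used.
nth : List ℕ → ℕ → ℕ
nth [] _ = 0
nth (x ∷ _) zero = x
nth (_ ∷ xs) (suc i) = nth xs i

relabel : List ℕ → List ℕ → List ℕ
relabel P = map (nth P)

nth-∷ʳ-< : ∀ P {x i} → i < length P → nth (P ∷ʳ x) i ≡ nth P i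
nth-∷ʳ-< (p ∷ P) {i = zero} _ = refl
nth-∷ʳ-< (p ∷ P) {i = suc i} (s≤s i<) = nth-∷ʳ-< P i<

nth-∷ʳ-length : ∀ P {x} → nth (P ∷ʳ x) (length P) ≡ x
nth-∷ʳ-length [] = refl
nth-∷ʳ-length (_ ∷ P) = nth-∷ʳ-length P

nth-All : ∀ {Q : ℕ → Set} {P i} → All Q P → i < length P → Q (nth P i)
nth-All {i = zero} (q ∷ _) _ = q
nth-All {i = suc i} (_ ∷ qs) (s≤s i<) = nth-All qs i<

nth-mono : ∀ {P i j} → StrictIncr P → i < j → j < length P → nth P i < nth P j
nth-mono {_ ∷ P} {zero} {suc j} P↑ _ (s≤s j<) = nth-All (strict-head P↑) j<
nth-mono {_ ∷ P} {suc i} {suc j} P↑ (s≤s i<j) (s≤s j<) = nth-mono (Linked.tail P↑) i<j j<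

nth-injective : ∀ {P i j} → StrictIncr P → i < length P → j < length P → nth P i ≡ nth P j → i ≡ j
nth-injective {i = i} {j} P↑ i< j< eq with <-cmp i j
... | tri< i<j _ _ = contradiction eq (<⇒≢ (nth-mono P↑ i<j j<))
... | tri≈ _ i≡j _ = i≡j
... | tri> _ _ j<i = contradiction eq (≢-sym (<⇒≢ (nth-mono P↑ j<i i<)))

relabel-∷ʳ : ∀ P {x e} → All (_< length P) e → relabel (P ∷ʳ x) e ≡ relabel P e
relabel-∷ʳ P [] = refl
relabel-∷ʳ P (i< ∷ e<) = cong₂ _∷_ (nth-∷ʳ-< P i<) (relabel-∷ʳ P e<)

relabel-All : ∀ {Q : ℕ → Set} {P e} → All Q P → All (_< length P) e → All Q (relabel P e)
relabel-All QP e< = map⁺ (All.map (nth-All QP) e<)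

relabel-strict : ∀ {P e} → StrictIncr P → StrictIncr e → All (_< length P) e → StrictIncr (relabel P e)
relabel-strict P↑ [] _ = []
relabel-strict P↑ [-] _ = [-]
relabel-strict P↑ (i<j ∷ e↑) (_ ∷ j< ∷ e<) = nth-mono P↑ i<j j< ∷ relabel-strict P↑ e↑ (j< ∷ e<)

relabel-injective : ∀ {P a b} → StrictIncr P → All (_< length P) a → All (_< length P) b →
  relabel P a ≡ relabel P b → a ≡ b
relabel-injective {a = []} {[]} _ _ _ _ = refl
relabel-injective {a = i ∷ a} {j ∷ b} P↑ (i< ∷ a<) (j< ∷ b<) eq =
  cong₂ _∷_ (nth-injective P↑ i< j< (proj₁ (∷-injective eq))) (relabel-injective P↑ a< b< (proj₂ (∷-injective eq)))

∑ : ∀ {n} → (Fin n → ℕ) → ℕ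
∑ {zero} _ = 0
∑ {suc n} f = f zero + ∑ (f ∘ suc)

∑-≤ : ∀ {n a} {f : Fin n → ℕ} → (∀ c → f c ≤ a) → ∑ f ≤ n * a
∑-≤ {zero} _ = z≤n
∑-≤ {suc n} f≤a = +-mono-≤ (f≤a zero) (∑-≤ (f≤a ∘ suc))

update : ∀ {n} {A : Fin n → Set} → (∀ c → A c) → (c : Fin n) → A c → ∀ c′ → A c′
update F zero a zero = a
update F zero a (suc c′) = F (suc c′)
update F (suc c) a zero = F zero
update F (suc c) a (suc c′) = update (F ∘ suc) c a c′

update-preserves : ∀ {n} {A : Fin n → Set} (Q : ∀ c → A c → Set) {F : ∀ c → A c} {c a} →
  (∀ c′ → Q c′ (F c′)) → Q c a → ∀ c′ → Q c′ (update F c a c′)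
update-preserves Q {c = zero} QF Qa zero = Qa
update-preserves Q {c = zero} QF Qa (suc c′) = QF (suc c′)
update-preserves Q {c = suc c} QF Qa zero = QF zero
update-preserves Q {c = suc c} QF Qa (suc c′) = update-preserves (Q ∘ suc) (QF ∘ suc) Qa c′

∑-update : ∀ {n} {A : Fin n → Set} (g : ∀ c → A c → ℕ) (F : ∀ c → A c) c {a d} → g c (F c) ≡ d + g c a →
  ∑ (λ c′ → g c′ (F c′)) ≡ d + ∑ (λ c′ → g c′ (update F c a c′))
∑-update g F zero {a} {d} eq = trans (cong (_+ rest) eq) (+-assoc d (g zero a) rest)
  where rest = ∑ (λ c′ → g (suc c′) (F (suc c′)))
∑-update g F (suc c) {a} {d} eq =
  trans (cong (g zero (F zero) +_) (∑-update (g ∘ suc) (F ∘ suc) c eq)) (+-left-comm (g zero (F zero)) d rest)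
  where rest = ∑ (λ c′ → g (suc c′) (update F (suc c) a (suc c′)))

∈-resp-edge : ∀ {q} {E : Board q} {e e′ c} → e ≡ e′ → (e , c) ∈ E → (e′ , c) ∈ E
∈-resp-edge refl mem = mem

no-win-without-edges : ∀ {q k V n b} {t : Fin q → ℕ} → (∀ c → k ≤ t c) → ¬ Wins k t V 0 n b []
no-win-without-edges {k = k} k≤t (done (c , S , _ , |S| , mono))
  with mono (take k S) (take-⊆ k S) (take-length S (subst (k ≤_) (sym |S|) (k≤t c)))
... | ()
no-win-without-edges k≤t (next _ _ W) = no-win-without-edges k≤t W

ColouredBy : ∀ {q} → (List ℕ → Fin q) → ℕ → Board q → Set
ColouredBy χ n E = ∀ {e c} → (e , c) ∈ E → χ e ≡ c × All (_< n) e

ColouredBy-mono : ∀ {q} {χ : List ℕ → Fin q} {n n′ E} → n ≤ n′ → ColouredBy χ n E → ColouredBy χ n′ E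
ColouredBy-mono n≤n′ col mem = proj₁ (col mem) , All.map (λ x<n → <-≤-trans x<n n≤n′) (proj₂ (col mem))

painter-follows : ∀ {q k V B n b E} {t : Fin q → ℕ} (χ : List ℕ → Fin q) → Wins k t V B n b E →
  1 ≤ n → n ≤ V → ColouredBy χ n E → ∃ λ E′ → ColouredBy χ V E′ × HasMonoClique k t E′
painter-follows χ (done h) _ n≤V col = _ , ColouredBy-mono n≤V col , h
painter-follows χ (build {n = n} {E = E} xs e↑ _ _ W) 1≤n n≤V col = painter-follows χ (W (χ e)) 1≤n n≤V col′
  where
  e = xs ∷ʳ (n ∸ 1)
  col′ : ColouredBy χ n ((e , χ e) ∷ E)
  col′ (here refl) = refl , new-edge-below xs 1≤n e↑
  col′ (there mem) = col mem
painter-follows χ (next _ n<V W) _ _ col = painter-follows χ W (s≤s z≤n) n<V (ColouredBy-mono (n≤1+n _) col)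

builderWins⇒ramseyBound : ∀ {q k V B} {t : Fin q → ℕ} → 1 ≤ k → (∀ c → k ≤ t c) →
  BuilderWins k t V B → RamseyBound k t V
builderWins⇒ramseyBound 1≤k k≤t (1≤V , W) χ with painter-follows χ W ≤-refl 1≤V (λ ())
... | _ , col , c , S , S↑ , |S| , mono =
  c , S , S↑ , All-from-sublists S 1≤k (subst (_ ≤_) (sym |S|) (k≤t c)) (λ e τ |e| → proj₂ (col (mono e τ |e|))) ,
  |S| , λ e τ |e| → proj₁ (col (mono e τ |e|))

repunit : ℕ → ℕ → ℕ
repunit q zero = 0
repunit q (suc B) = suc (q * repunit q B)

slotBound : ℕ → Bool → ℕ → ℕ
slotBound q true B = repunit q B
slotBound q false B = repunit q B ∸ 1

slotBound-false≤ : ∀ q b B → slotBound q false B ≤ slotBound q b B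
slotBound-false≤ q true B = m∸n≤m (repunit q B) 1
slotBound-false≤ q false B = ≤-refl

repunit-bound : ∀ {q} → 2 ≤ q → ∀ B → 2 + q * repunit q B ≤ q ^ suc B
repunit-bound {q} 2≤q zero = begin
  2 + q * 0 ≡⟨ cong (2 +_) (*-zeroʳ q) ⟩
  2         ≤⟨ 2≤q ⟩
  q         ≡⟨ *-identityʳ q ⟨
  q * 1     ∎
  where open ≤-Reasoning
repunit-bound {q} 2≤q (suc B) = begin
  2 + q * repunit q (suc B)    ≤⟨ +-monoˡ-≤ _ 2≤q ⟩
  q + q * repunit q (suc B)    ≡⟨ *-suc q _ ⟨
  q * (2 + q * repunit q B)    ≤⟨ *-monoʳ-≤ q (repunit-bound 2≤q B) ⟩
  q * q ^ suc B                ∎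
  where open ≤-Reasoning

slotBound-fits : ∀ {q m} → 2 ≤ q → 1 ≤ m → 2 + slotBound q false m ≤ q ^ m
slotBound-fits {m = suc B} 2≤q _ = repunit-bound 2≤q B

vertices-fit : ∀ {q k′ m C} → 2 ≤ q → 1 ≤ k′ → 1 ≤ m → C ≤ (k′ ∸ 1) + slotBound q false m →
  2 + C ≤ q ^ m + suc k′ ∸ 2
vertices-fit {q} {k′} {m} {C} 2≤q 1≤k′ 1≤m C≤ = begin
  2 + C                 ≤⟨ +-monoʳ-≤ 2 C≤ ⟩
  2 + ((k′ ∸ 1) + R)    ≡⟨ +-left-comm 2 (k′ ∸ 1) R ⟩
  (k′ ∸ 1) + (2 + R)    ≤⟨ +-monoʳ-≤ (k′ ∸ 1) (slotBound-fits 2≤q 1≤m) ⟩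
  (k′ ∸ 1) + q ^ m      ≡⟨ +-comm (k′ ∸ 1) (q ^ m) ⟩
  q ^ m + (suc k′ ∸ 2)  ≡⟨ +-∸-assoc (q ^ m) (s≤s 1≤k′) ⟨
  q ^ m + suc k′ ∸ 2    ∎
  where
  open ≤-Reasoning
  R = slotBound q false m

edges-fit : ∀ {q m C} → 2 ≤ q → 1 ≤ m → C ≤ m * slotBound q false m → m + C ≤ m * q ^ m
edges-fit {q} {m} {C} 2≤q 1≤m C≤ = begin
  m + C          ≤⟨ +-monoʳ-≤ m C≤ ⟩
  m + m * R      ≡⟨ *-suc m R ⟨
  m * suc R      ≤⟨ *-monoʳ-≤ m (≤-trans (n≤1+n (suc R)) (slotBound-fits 2≤q 1≤m)) ⟩
  m * q ^ m      ∎
  where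
  open ≤-Reasoning
  R = slotBound q false m

module SlotTrees {q : ℕ} (k₀ : ℕ) (t₀ : Fin q → ℕ) (V₀ : ℕ) where

  Strategy : ℕ → ℕ → Bool → Board q → Set
  Strategy = Wins {q} k₀ t₀ V₀

  Tree : ∀ {B n b E} → Strategy B n b E → Set
  Tree (done _) = ⊤
  Tree (build _ _ _ _ W) = ∀ c → Tree (W c)
  Tree (next _ _ W) = Maybe (ℕ × Tree W)

  empty : ∀ {B n b E} (W : Strategy B n b E) → Tree W
  empty (done _) = tt
  empty (build _ _ _ _ W) = λ c → empty (W c)
  empty (next _ _ _) = nothing

  -- A slot in front of a finished position is never filled, so it weighs nothing.
  slotWeight : (ℕ → ℕ) → ∀ {B n b E} → Strategy B n b E → ℕ
  slotWeight wt (done _) = 0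
  slotWeight wt {B} _ = wt B

  free : (ℕ → ℕ) → ∀ {B n b E} (W : Strategy B n b E) → Tree W → ℕ
  free wt (done _) _ = 0
  free wt (build _ _ _ _ W) T = ∑ λ c → free wt (W c) (T c)
  free wt (next _ _ W) nothing = slotWeight wt W + free wt W (empty W)
  free wt (next _ _ W) (just (_ , T)) = free wt W T

  capacity : (ℕ → ℕ) → ∀ {B n b E} → Strategy B n b E → ℕ
  capacity wt W = free wt W (empty W)

  finished-or-weighted : ∀ {B n b E} (W : Strategy B n b E) →
    HasMonoClique k₀ t₀ E ⊎ (∀ wt → slotWeight wt W ≡ wt B)
  finished-or-weighted (done h) = inj₁ h
  finished-or-weighted (build _ _ _ _ _) = inj₂ λ _ → refl
  finished-or-weighted (next _ _ _) = inj₂ λ _ → refl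

  early-slot-bound : ∀ a M {c B n} b → n < k₀ → c ≤ a * (k₀ ∸ suc n) + M * slotBound q false B →
    a + c ≤ a * (k₀ ∸ n) + M * slotBound q b B
  early-slot-bound a M {c} {B} {n} b n<k₀ c≤ = begin
    a + c                                ≤⟨ +-monoʳ-≤ a c≤ ⟩
    a + (a * (k₀ ∸ suc n) + M * R)       ≡⟨ +-assoc a _ _ ⟨
    a + a * (k₀ ∸ suc n) + M * R         ≡⟨ cong (_+ M * R) (*-suc a _) ⟨
    a * suc (k₀ ∸ suc n) + M * R         ≡⟨ cong (λ r → a * r + M * R) (+-∸-assoc 1 n<k₀) ⟨
    a * (k₀ ∸ n) + M * R                 ≤⟨ +-monoʳ-≤ (a * (k₀ ∸ n)) (*-monoʳ-≤ M (slotBound-false≤ q b B)) ⟩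
    a * (k₀ ∸ n) + M * slotBound q b B   ∎
    where
    open ≤-Reasoning
    R = slotBound q false B

  late-slot-bound : ∀ a M {c B n} → k₀ ≤ n → a ≤ M → c ≤ a * (k₀ ∸ suc n) + M * slotBound q false (suc B) →
    a + c ≤ a * (k₀ ∸ n) + M * slotBound q true (suc B)
  late-slot-bound a M {c} {B} {n} k₀≤n a≤M c≤ = begin
    a + c                           ≤⟨ +-mono-≤ a≤M (subst (c ≤_) no-early-slots c≤) ⟩
    M + M * (q * repunit q B)       ≡⟨ *-suc M _ ⟨
    M * repunit q (suc B)           ≤⟨ m≤n+m _ _ ⟩
    a * (k₀ ∸ n) + M * repunit q (suc B) ∎
    where
    open ≤-Reasoning
    no-early-slots : a * (k₀ ∸ suc n) + M * (q * repunit q B) ≡ M * (q * repunit q B)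
    no-early-slots =
      cong (_+ M * (q * repunit q B)) (trans (cong (a *_) (m≤n⇒m∸n≡0 (m≤n⇒m≤1+n k₀≤n))) (*-zeroʳ a))

  build-bound : ∀ a a′ M {B n} b {f : Fin q → ℕ} → k₀ ≤ n →
    (∀ c → f c ≤ a′ * (k₀ ∸ n) + M * slotBound q true B) →
    ∑ f ≤ a * (k₀ ∸ n) + M * slotBound q b (suc B)
  build-bound a a′ M {B} {n} b {f} k₀≤n f≤ = begin
    ∑ f                            ≤⟨ ∑-≤ (λ c → subst (f c ≤_) no-early-slots (f≤ c)) ⟩
    q * (M * repunit q B)          ≡⟨ *-left-comm q M (repunit q B) ⟩
    M * slotBound q false (suc B)  ≤⟨ *-monoʳ-≤ M (slotBound-false≤ q b (suc B)) ⟩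
    M * slotBound q b (suc B)      ≤⟨ m≤n+m _ _ ⟩
    a * (k₀ ∸ n) + M * slotBound q b (suc B) ∎
    where
    open ≤-Reasoning
    no-early-slots : a′ * (k₀ ∸ n) + M * repunit q B ≡ M * repunit q B
    no-early-slots = cong (_+ M * repunit q B) (trans (cong (a′ *_) (m≤n⇒m∸n≡0 k₀≤n)) (*-zeroʳ a′))

  -- At most k₀ ∸ n slots come before round k₀ and keep the budget B. Every later slot follows a
  -- build, so these lie in a q-ary tree of depth B, which has a slot at its root only if b.
  capacity-bound : ∀ {wt M} → (∀ B → wt B ≤ M) →
    ∀ {B n b E} (W : Strategy B n b E) → 1 ≤ n → (b ≡ true → k₀ ≤ n) →
    capacity wt W ≤ wt B * (k₀ ∸ n) + M * slotBound q b B
  capacity-bound wt≤M (done _) _ _ = z≤n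
  capacity-bound {wt} {M} wt≤M {suc B} {b = b} (build xs e↑ |xs| _ W) 1≤n _ =
    build-bound (wt (suc B)) (wt B) M b k₀≤n (λ c → capacity-bound wt≤M (W c) 1≤n (λ _ → k₀≤n))
    where k₀≤n = new-edge⇒k≤n xs 1≤n e↑ |xs|
  capacity-bound wt≤M (next _ _ (done _)) _ _ = z≤n
  capacity-bound {wt} {M} wt≤M {B} {b = b} (next (inj₁ n<k₀) _ W@(build _ _ _ _ _)) _ _ =
    early-slot-bound (wt B) M b n<k₀ (capacity-bound wt≤M W (s≤s z≤n) λ ())
  capacity-bound {wt} {M} wt≤M {suc B} (next (inj₂ refl) _ W@(build _ _ _ _ _)) _ k₀≤n =
    late-slot-bound (wt (suc B)) M (k₀≤n refl) (wt≤M (suc B)) (capacity-bound wt≤M W (s≤s z≤n) λ ())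
  capacity-bound {wt} {M} wt≤M {B} {b = b} (next _ _ W@(next (inj₁ n+1<k₀) _ _)) _ _ =
    early-slot-bound (wt B) M b (<-trans (n<1+n _) n+1<k₀) (capacity-bound wt≤M W (s≤s z≤n) λ ())

  capacity-count : ∀ {B E} (W : Strategy B 1 false E) → capacity (const 1) W ≤ (k₀ ∸ 1) + slotBound q false B
  capacity-count W = ≤-trans (capacity-bound (λ _ → ≤-refl) W ≤-refl λ ())
    (≤-reflexive (cong₂ _+_ (*-identityˡ (k₀ ∸ 1)) (*-identityˡ _)))

  capacity-spent : ∀ {m E} (W : Strategy m 1 false E) → capacity (m ∸_) W ≤ m * slotBound q false m
  capacity-spent {m} W = ≤-trans (capacity-bound (λ B → m∸n≤m m B) W ≤-refl λ ())
    (≤-reflexive (cong (λ d → d * (k₀ ∸ 1) + m * slotBound q false m) (n∸n≡0 m)))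

module SteppingUp {q k′ : ℕ} (t : Fin q → ℕ) (1≤k′ : 1 ≤ k′) (k′<t : ∀ c → suc k′ < t c) (V m V′ : ℕ) where

  t′ : Fin q → ℕ
  t′ c = t c ∸ 1

  k′≤t′ : ∀ c → k′ ≤ t′ c
  k′≤t′ c = <⇒≤ (∸-monoˡ-≤ 1 (k′<t c))

  open SlotTrees k′ t′ V′

  Real : ℕ → ℕ → Bool → Board q → Set
  Real = Wins {q} (suc k′) t V

  Realises : Board q → List ℕ → Board q → ℕ → Set
  Realises E P E′ x = ∀ {e′ c} → (e′ , c) ∈ E′ → (relabel P e′ ∷ʳ x , c) ∈ E

  record Occupant (E : Board q) (w : ℕ) (P : List ℕ) (E′ : Board q) (x : ℕ) : Set where
    field
      x<w : x < w
      P<x : All (_< x) P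
      realises : Realises E P E′ x

  occupant-weaken : ∀ {E E₂ w w₂ P E′ x} → E ⊆ₛ E₂ → w ≤ w₂ → Occupant E w P E′ x → Occupant E₂ w₂ P E′ x
  occupant-weaken E⊆E₂ w≤w₂ o = record
    { x<w = <-≤-trans x<w w≤w₂ ; P<x = P<x ; realises = λ mem → E⊆E₂ (realises mem) }
    where open Occupant o

  Valid : ∀ {B n b E′} → Board q → ℕ → List ℕ → (W : Strategy B n b E′) → Tree W → Set
  Valid E w P (done _) _ = ⊤
  Valid E w P (build _ _ _ _ W) T = ∀ c → Valid E w P (W c) (T c)
  Valid E w P (next _ _ W) nothing = ⊤
  Valid {E′ = E′} E w P (next _ _ W) (just (x , T)) = Occupant E w P E′ x × Valid E w (P ∷ʳ x) W T

  valid-weaken : ∀ {B n b E′ E E₂ w w₂ P} → E ⊆ₛ E₂ → w ≤ w₂ →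
    (W : Strategy B n b E′) (T : Tree W) → Valid E w P W T → Valid E₂ w₂ P W T
  valid-weaken E⊆E₂ w≤w₂ (done _) _ _ = tt
  valid-weaken E⊆E₂ w≤w₂ (build _ _ _ _ W) T v = λ c → valid-weaken E⊆E₂ w≤w₂ (W c) (T c) (v c)
  valid-weaken E⊆E₂ w≤w₂ (next _ _ W) nothing _ = tt
  valid-weaken E⊆E₂ w≤w₂ (next _ _ W) (just (x , T)) (o , v) =
    occupant-weaken E⊆E₂ w≤w₂ o , valid-weaken E⊆E₂ w≤w₂ W T v

  valid-empty : ∀ {B n b E′ E w P} (W : Strategy B n b E′) → Valid E w P W (empty W)
  valid-empty (done _) = tt
  valid-empty (build _ _ _ _ W) = λ c → valid-empty (W c)
  valid-empty (next _ _ _) = tt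

  -- The auxiliary vertices 0, …, n ∸ 1 are played by the real vertices P, and w is the real vertex
  -- being placed; E′ is the auxiliary board and E the real one.
  record Embeds (E : Board q) (w : ℕ) (P : List ℕ) (n : ℕ) (E′ : Board q) : Set where
    field
      length-P : length P ≡ n
      1≤n : 1 ≤ n
      P↑ : StrictIncr P
      P<w : All (_< w) P
      aux-below : ∀ {e′ c} → (e′ , c) ∈ E′ → All (_< n) e′
      -- Every auxiliary edge below j existed when P j settled, so P j built its lift.
      past-edges : ∀ {j e′ c} → j < n → (e′ , c) ∈ E′ → All (_< j) e′ → (relabel P e′ ∷ʳ nth P j , c) ∈ E
      current-edges : Realises E P E′ w
      real-edges : ∀ {e c} → (e , c) ∈ E →
        All (_< w) e ⊎ ∃₂ λ e′ c′ → (e′ , c′) ∈ E′ × e ≡ relabel P e′ ∷ʳ w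

  embeds-root : ∀ {E w} → 1 ≤ w → (∀ {e c} → (e , c) ∈ E → All (_< w) e) → Embeds E w (0 ∷ []) 1 []
  embeds-root 1≤w below = record
    { length-P = refl ; 1≤n = ≤-refl ; P↑ = [-] ; P<w = 1≤w ∷ [] ; aux-below = λ ()
    ; past-edges = λ _ () ; current-edges = λ () ; real-edges = λ mem → inj₁ (below mem) }

  module _ {E w P n E′} (I : Embeds E w P n E′) where
    open Embeds I

    below-P : ∀ {e} → All (_< n) e → All (_< length P) e
    below-P {e} = subst (λ z → All (_< z) e) (sym length-P)

    lift-strict : ∀ {e′} → StrictIncr e′ → All (_< n) e′ → StrictIncr (relabel P e′ ∷ʳ w)
    lift-strict e′↑ e′<n = strict-∷ʳ⁺ (relabel-strict P↑ e′↑ (below-P e′<n)) (relabel-All P<w (below-P e′<n))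

    lift-fresh : ∀ {a} → All (_< n) a → (∀ c → (a , c) ∉ E′) → ∀ c → (relabel P a ∷ʳ w , c) ∉ E
    lift-fresh {a} a<n fresh c mem with real-edges mem
    ... | inj₁ below = <-irrefl refl (proj₂ (∷ʳ⁻ {xs = relabel P a} below))
    ... | inj₂ (e′ , c′ , mem′ , eq) = fresh c′ (∈-resp-edge (sym a≡e′) mem′)
      where a≡e′ = relabel-injective P↑ (below-P a<n) (below-P (aux-below mem′)) (∷ʳ-injectiveˡ _ _ eq)

    edges-below-next : ∀ {e c} → (e , c) ∈ E → All (_< suc w) e
    edges-below-next mem with real-edges mem
    ... | inj₁ below = All.map m<n⇒m<1+n below
    ... | inj₂ (e′ , _ , mem′ , refl) =
      ∷ʳ⁺ (relabel-All (All.map m<n⇒m<1+n P<w) (below-P (aux-below mem′))) ≤-refl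

    -- A k-set of the lifted clique either contains w, and comes from an auxiliary edge through
    -- current-edges, or its last vertex is some P j, and it was built when P j was placed.
    lift-mono-clique : ∀ {c C} → StrictIncr C → All (_< n) C → MonoCliqueOn k′ E′ c C →
      MonoCliqueOn (suc k′) E c (relabel P C ∷ʳ w)
    lift-mono-clique {c} {C} C↑ C<n mono e τ |e| with ⊆-∷ʳ-split (relabel P C) τ
    ... | inj₂ (e₀ , refl , σ) with ⊆-map-preimage (nth P) C σ
    ...   | e′ , e′⊆C , refl = current-edges (mono e′ e′⊆C |e′|)
      where |e′| = trans (sym (length-map (nth P) e′)) (suc-injective (trans (sym (length-∷ʳ (relabel P e′))) |e|))
    lift-mono-clique {c} {C} C↑ C<n mono e τ |e| | inj₁ σ with ⊆-map-preimage (nth P) C σ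
    ... | e′ , e′⊆C , refl = old-edge e′ e′⊆C (trans (sym (length-map (nth P) e′)) |e|)
      where
      old-edge : ∀ e′ → e′ ⊆ C → length e′ ≡ suc k′ → (relabel P e′ , c) ∈ E
      old-edge e′ e′⊆C |e′| with initLast e′
      old-edge .(e₀ ∷ʳ j) e′⊆C |e′| | e₀ ∷ʳ′ j =
        ∈-resp-edge (sym (map-++ (nth P) e₀ (j ∷ []))) (past-edges j<n (mono e₀ e₀⊆C |e₀|) e₀<j)
        where
        j<n = proj₂ (∷ʳ⁻ {xs = e₀} (All-resp-⊆ e′⊆C C<n))
        e₀<j = proj₂ (strict-∷ʳ⁻ e₀ (strict-⊆ e′⊆C C↑))
        e₀⊆C = ⊆-trans (++⁺ʳ (j ∷ []) ⊆-refl) e′⊆C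
        |e₀| = suc-injective (trans (sym (length-∷ʳ e₀)) |e′|)

    lift-clique : HasMonoClique k′ t′ E′ → HasMonoClique (suc k′) t E
    lift-clique (c , C , C↑ , |C| , mono) =
      c , relabel P C ∷ʳ w , lift-strict C↑ C<n , size , lift-mono-clique C↑ C<n mono
      where
      C<n : All (_< n) C
      C<n = All-from-sublists C 1≤k′ (subst (k′ ≤_) (sym |C|) (k′≤t′ c)) (λ e τ |e| → aux-below (mono e τ |e|))
      size : length (relabel P C ∷ʳ w) ≡ t c
      size = trans (length-∷ʳ (relabel P C)) (trans (cong suc (trans (length-map (nth P) C) |C|))
               (m+[n∸m]≡n (<⇒≤ (≤-<-trans (s≤s z≤n) (k′<t c)))))

  embeds-∷ʳ : ∀ {E w P n E′ x} → Embeds E w P n E′ → Occupant E w P E′ x → Embeds E w (P ∷ʳ x) (suc n) E′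
  embeds-∷ʳ {E} {w} {P} {n} {E′} {x} I o = record
    { length-P = trans (length-∷ʳ P) (cong suc length-P)
    ; 1≤n = s≤s z≤n
    ; P↑ = strict-∷ʳ⁺ P↑ P<x
    ; P<w = ∷ʳ⁺ P<w x<w
    ; aux-below = λ mem → All.map m<n⇒m<1+n (aux-below mem)
    ; past-edges = past
    ; current-edges = λ mem → ∈-resp-edge (cong (_∷ʳ w) (sym (unchanged mem))) (current-edges mem)
    ; real-edges = λ mem → Sum.map₂ relift (real-edges mem)
    }
    where
    open Embeds I
    open Occupant o
    unchanged : ∀ {e′ c} → (e′ , c) ∈ E′ → relabel (P ∷ʳ x) e′ ≡ relabel P e′
    unchanged mem = relabel-∷ʳ P (below-P I (aux-below mem))
    relift : ∀ {e} → (∃₂ λ e′ c′ → (e′ , c′) ∈ E′ × e ≡ relabel P e′ ∷ʳ w) →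
      ∃₂ λ e′ c′ → (e′ , c′) ∈ E′ × e ≡ relabel (P ∷ʳ x) e′ ∷ʳ w
    relift (e′ , c′ , mem′ , eq) = e′ , c′ , mem′ , trans eq (cong (_∷ʳ w) (sym (unchanged mem′)))
    nth-n : nth (P ∷ʳ x) n ≡ x
    nth-n = subst (λ i → nth (P ∷ʳ x) i ≡ x) length-P (nth-∷ʳ-length P)
    past : ∀ {j e′ c} → j < suc n → (e′ , c) ∈ E′ → All (_< j) e′ →
      (relabel (P ∷ʳ x) e′ ∷ʳ nth (P ∷ʳ x) j , c) ∈ E
    past {j} j<n+1 mem e′<j with m≤n⇒m<n∨m≡n (≤-pred j<n+1)
    ... | inj₁ j<n = ∈-resp-edge (sym (cong₂ _∷ʳ_ (unchanged mem) (nth-∷ʳ-< P (subst (j <_) (sym length-P) j<n))))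
                       (past-edges j<n mem e′<j)
    ... | inj₂ refl = ∈-resp-edge (sym (cong₂ _∷ʳ_ (unchanged mem) nth-n)) (realises mem)

  embeds-build : ∀ {E w P n E′ xs} c → Embeds E w P n E′ → StrictIncr (xs ∷ʳ (n ∸ 1)) →
    Embeds ((relabel P (xs ∷ʳ (n ∸ 1)) ∷ʳ w , c) ∷ E) w P n ((xs ∷ʳ (n ∸ 1) , c) ∷ E′)
  embeds-build {E} {w} {P} {n} {E′} {xs} c I a↑ = record
    { length-P = length-P ; 1≤n = 1≤n ; P↑ = P↑ ; P<w = P<w
    ; aux-below = λ { (here refl) → new-edge-below xs 1≤n a↑ ; (there mem) → aux-below mem }
    ; past-edges = λ { j<n (here refl) a<j → contradiction a<j (stale j<n)
                     ; j<n (there mem) e′<j → there (past-edges j<n mem e′<j) }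
    ; current-edges = λ { (here refl) → here refl ; (there mem) → there (current-edges mem) }
    ; real-edges = λ { (here refl) → inj₂ (_ , c , here refl , refl)
                     ; (there mem) → Sum.map₂ (λ (e′ , c′ , mem′ , eq) → e′ , c′ , there mem′ , eq) (real-edges mem) }
    }
    where
    open Embeds I
    stale : ∀ {j} → j < n → ¬ All (_< j) (xs ∷ʳ (n ∸ 1))
    stale j<n a<j = <⇒≱ j<n (subst (_≤ _) (m+[n∸m]≡n 1≤n) (proj₂ (∷ʳ⁻ {xs = xs} a<j)))

  record Placed {B n b′ E′} (W : Strategy B n b′ E′) (T : Tree W) (P : List ℕ) (w : ℕ) (E : Board q) (X : ℕ)
                (E₂ : Board q) (b₂ : Bool) (Br₂ : ℕ) : Set where
    field
      tree : Tree W
      valid : Valid E₂ (suc w) P W tree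
      extends : E ⊆ₛ E₂
      may-reveal : suc w < suc k′ ⊎ b₂ ≡ true
      edges-below : ∀ {e c} → (e , c) ∈ E₂ → All (_< suc w) e
      slot-budget : ℕ
      slot-budget≤m : slot-budget ≤ m
      spent : slot-budget + X ≤ Br₂
      free-drop : ∀ wt → free wt W T ≡ wt slot-budget + free wt W tree

  Cont : ∀ {B n b′ E′} (W : Strategy B n b′ E′) → Tree W → List ℕ → ℕ → Board q → ℕ → Set
  Cont W T P w E X = ∀ {E₂ b₂ Br₂} → Placed W T P w E X E₂ b₂ Br₂ → Real Br₂ (suc w) b₂ E₂

  record Walking {B n b′ E′} (W : Strategy B n b′ E′) (T : Tree W) (P : List ℕ) (w : ℕ) (E : Board q)
                 (b : Bool) (X Br : ℕ) : Set where
    field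
      embeds : Embeds E w P n E′
      tree-valid : Valid E w P W T
      B≤m : B ≤ m
      -- w may still spend B edges; X is reserved for the vertices placed after it.
      budget : B + X ≤ Br
      built : b′ ≡ true → b ≡ true
      -- While w has built nothing in this round, the vertices placed before it are exactly
      -- the n on its path and those in the subtree T.
      unbuilt-count : b ≡ false → w + free (const 1) W T ≡ n + capacity (const 1) W

  reveal-allowed : ∀ {n b′ b w C} → n < k′ ⊎ b′ ≡ true → (b′ ≡ true → b ≡ true) →
    (b ≡ false → w + C ≡ n + C) → suc w < suc k′ ⊎ b ≡ true
  reveal-allowed {b = true} _ _ _ = inj₂ refl
  reveal-allowed {b = false} (inj₁ n<k′) _ count =
    inj₁ (s≤s (subst (_< k′) (sym (+-cancelʳ-≡ _ _ _ (count refl))) n<k′))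
  reveal-allowed {b = false} (inj₂ b′≡true) built _ = contradiction (built b′≡true) λ ()

  module _ {B n b′ E′ xs a↑ |xs| fresh} {W : ∀ c → Strategy B n true ((xs ∷ʳ (n ∸ 1) , c) ∷ E′)}
           {T : Tree (build {b = b′} xs a↑ |xs| fresh W)} {P w E b X Br}
           (s : Walking (build {b = b′} xs a↑ |xs| fresh W) T P w E b X (suc Br)) where
    open Walking s

    private
      E₁ : Fin q → Board q
      E₁ c = (relabel P (xs ∷ʳ (n ∸ 1)) ∷ʳ w , c) ∷ E

    walking-build : ∀ c → Walking (W c) (T c) P w (E₁ c) true X Br
    walking-build c = record
      { embeds = embeds-build c embeds a↑ ; tree-valid = valid-weaken there ≤-refl (W c) (T c) (tree-valid c)
      ; B≤m = <⇒≤ B≤m ; budget = ≤-pred budget ; built = λ _ → refl ; unbuilt-count = λ () }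

    placed-build : ∀ c {E₂ b₂ Br₂} → Placed (W c) (T c) P w (E₁ c) X E₂ b₂ Br₂ →
      Placed (build {b = b′} xs a↑ |xs| fresh W) T P w E X E₂ b₂ Br₂
    placed-build c p = record
      { tree = update T c tree
      ; valid = update-preserves (λ c′ → Valid _ (suc w) P (W c′))
                  (λ c′ → valid-weaken (λ mem → extends (there mem)) (n≤1+n w) (W c′) (T c′) (tree-valid c′)) valid
      ; extends = λ mem → extends (there mem)
      ; may-reveal = may-reveal ; edges-below = edges-below
      ; slot-budget = slot-budget ; slot-budget≤m = slot-budget≤m ; spent = spent
      ; free-drop = λ wt → ∑-update (λ c′ → free wt (W c′)) T c (free-drop wt)
      }
      where open Placed p

  module _ {B n b′ E′} {cond : n < k′ ⊎ b′ ≡ true} {le : suc n ≤ V′} {W : Strategy B (suc n) false E′}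
           {P : List ℕ} {w : ℕ} {E : Board q} {b : Bool} {X Br : ℕ} (weighs : ∀ wt → slotWeight wt W ≡ wt B) where

    placed-settle : Walking (next {b = b′} cond le W) nothing P w E b X Br →
      Placed (next {b = b′} cond le W) nothing P w E X E b Br
    placed-settle s = record
      { tree = just (w , empty W)
      ; valid = record { x<w = ≤-refl ; P<x = Embeds.P<w embeds ; realises = Embeds.current-edges embeds } , valid-empty W
      ; extends = λ mem → mem
      ; may-reveal = reveal-allowed cond built unbuilt-count
      ; edges-below = edges-below-next embeds
      ; slot-budget = B ; slot-budget≤m = B≤m ; spent = budget
      ; free-drop = λ wt → cong (_+ capacity wt W) (weighs wt)
      }
      where open Walking s

    walking-descend : ∀ {x T} → Walking (next {b = b′} cond le W) (just (x , T)) P w E b X Br →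
      Walking W T (P ∷ʳ x) w E b X Br
    walking-descend s = record
      { embeds = embeds-∷ʳ embeds (proj₁ tree-valid) ; tree-valid = proj₂ tree-valid ; B≤m = B≤m ; budget = budget
      ; built = λ () ; unbuilt-count = λ b≡false → trans (unbuilt-count b≡false)
          (trans (cong (λ s → n + (s + capacity (const 1) W)) (weighs (const 1))) (+-suc n _))
      }
      where open Walking s

  placed-ascend : ∀ {B n b′ E′ cond le} {W : Strategy B (suc n) false E′} {x T P w E X E₂ b₂ Br₂} →
    Occupant E w P E′ x → Placed W T (P ∷ʳ x) w E X E₂ b₂ Br₂ →
    Placed (next {b = b′} cond le W) (just (x , T)) P w E X E₂ b₂ Br₂
  placed-ascend {x = x} {w = w} o p = record
    { tree = just (x , tree) ; valid = occupant-weaken extends (n≤1+n w) o , valid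
    ; extends = extends ; may-reveal = may-reveal ; edges-below = edges-below
    ; slot-budget = slot-budget ; slot-budget≤m = slot-budget≤m ; spent = spent ; free-drop = free-drop }
    where open Placed p

  walk : ∀ {B n b′ E′} (W : Strategy B n b′ E′) (T : Tree W) {P w E b X Br} →
    Walking W T P w E b X Br → Cont W T P w E X → Real Br (suc w) b E
  walk (done h) _ s _ = done (lift-clique (Walking.embeds s) h)
  walk (build _ _ _ _ _) _ {Br = zero} s _ = contradiction (Walking.budget s) λ ()
  walk {n = n} (build xs a↑ |xs| fresh W) T {P} {Br = suc _} s cont =
    build (relabel P a) (lift-strict embeds a↑ a<n) |a| (lift-fresh embeds a<n fresh)
      λ c → walk (W c) (T c) (walking-build s c) (cont ∘ placed-build s c)
    where
    open Walking s
    a = xs ∷ʳ (n ∸ 1)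
    a<n = new-edge-below xs (Embeds.1≤n embeds) a↑
    |a| : length (relabel P a) ≡ k′
    |a| = trans (length-map (nth P) a) (trans (length-∷ʳ xs) (trans (cong suc |xs|) (m+[n∸m]≡n 1≤k′)))
  walk (next _ _ W) T s cont with finished-or-weighted W
  walk (next _ _ W) T s cont | inj₁ h = done (lift-clique (Walking.embeds s) h)
  walk (next _ _ W) nothing s cont | inj₂ weighs = cont (placed-settle weighs s)
  walk (next _ _ W) (just (x , T)) s cont | inj₂ weighs =
    walk W T (walking-descend weighs s) (cont ∘ placed-ascend (proj₁ (Walking.tree-valid s)))

  module _ (W₀ : Strategy m 1 false []) (fits : 2 + capacity (const 1) W₀ ≤ V) where

    play : ∀ f (T : Tree W₀) {w E Br} → 1 ≤ w → free (const 1) W₀ T ≡ f → w + f ≡ suc (capacity (const 1) W₀) →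
      Valid E w (0 ∷ []) W₀ T → (∀ {e c} → (e , c) ∈ E → All (_< w) e) → m + free (m ∸_) W₀ T ≤ Br →
      Real Br (suc w) false E
    play f T {w} {E} {Br} 1≤w free≡f count T-valid below affordable = walk W₀ T start (continue f free≡f count)
      where
      start : Walking W₀ T (0 ∷ []) w E false (free (m ∸_) W₀ T) Br
      start = record
        { embeds = embeds-root 1≤w below ; tree-valid = T-valid ; B≤m = ≤-refl ; budget = affordable
        ; built = λ () ; unbuilt-count = λ _ → trans (cong (w +_) free≡f) count }
      continue : ∀ f → free (const 1) W₀ T ≡ f → w + f ≡ suc (capacity (const 1) W₀) →
        Cont W₀ T (0 ∷ []) w E (free (m ∸_) W₀ T)
      continue zero free≡0 _ p = contradiction (trans (sym free≡0) (Placed.free-drop p (const 1))) λ ()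
      continue (suc f) free≡f+1 count {Br₂ = Br₂} p =
        next may-reveal room (play f tree (s≤s z≤n) free′ (trans (sym (+-suc w f)) count) valid edges-below affordable′)
        where
        open Placed p
        free′ : free (const 1) W₀ tree ≡ f
        free′ = suc-injective (trans (sym (free-drop (const 1))) free≡f+1)
        room : suc (suc w) ≤ V
        room = ≤-trans (s≤s (s≤s (subst (w ≤_) (suc-injective (trans (sym (+-suc w f)) count)) (m≤m+n w f)))) fits
        affordable′ : m + free (m ∸_) W₀ tree ≤ Br₂
        affordable′ = begin
          m + F tree                                 ≡⟨ cong (_+ F tree) (m+[n∸m]≡n slot-budget≤m) ⟨
          slot-budget + (m ∸ slot-budget) + F tree   ≡⟨ +-assoc slot-budget _ _ ⟩
          slot-budget + ((m ∸ slot-budget) + F tree) ≡⟨ cong (slot-budget +_) (free-drop (m ∸_)) ⟨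
          slot-budget + F T                          ≤⟨ spent ⟩
          Br₂                                        ∎
          where
          open ≤-Reasoning
          F = free (m ∸_) W₀

    step-up : ∀ {Br} → m + capacity (m ∸_) W₀ ≤ Br → BuilderWins (suc k′) t V Br
    step-up affordable =
      ≤-trans (s≤s z≤n) 2≤V ,
      next (inj₁ (s≤s 1≤k′)) 2≤V (play _ (empty W₀) ≤-refl refl refl (valid-empty W₀) (λ ()) affordable)
      where 2≤V = ≤-trans (m≤m+n 2 _) fits

theorem2p1 : (q k : ℕ) (t : Fin q → ℕ) → 2 ≤ q → 2 ≤ k → (∀ c → k < t c) →
    (m : ℕ) → IsVertexOnlineRamsey (k ∸ 1) (λ c → t c ∸ 1) m →
    BuilderWins k t (q ^ m + k ∸ 2) (m * q ^ m)
    × RamseyBound k t (q ^ m + k ∸ 2)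
    × (∀ r → IsVertexOnlineRamsey k t r → r ≤ m * q ^ m)
theorem2p1 q (suc k′) t 2≤q (s≤s 1≤k′) k<t m ((V′ , _ , W₀) , _) =
  builder-wins , builderWins⇒ramseyBound (s≤s z≤n) (<⇒≤ ∘ k<t) builder-wins ,
  λ r (_ , r-minimal) → r-minimal _ (_ , builder-wins)
  where
  open SteppingUp t 1≤k′ k<t (q ^ m + suc k′ ∸ 2) m V′
  open SlotTrees k′ t′ V′
  1≤m : 1 ≤ m
  1≤m = n≢0⇒n>0 λ { refl → no-win-without-edges k′≤t′ W₀ }
  builder-wins : BuilderWins (suc k′) t (q ^ m + suc k′ ∸ 2) (m * q ^ m)
  builder-wins = step-up W₀
    (vertices-fit 2≤q 1≤k′ 1≤m (capacity-count W₀))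
    (edges-fit 2≤q 1≤m (capacity-spent W₀))
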